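{- Let $G=(V,E)$ be any graph on $n$ vertices (connected or otherwise). Then there exists a connected graph $G'$ on at most $n+2$ vertices containing an induced copy of $G$ and satisfying $\iota(G')<\infty$.
   Context: All graphs are finite, simple, undirected. For a connected graph $G$ with vertices $v_1,\dots,v_n$, $D=(d(v_i,v_j))_{i,j}$ is its shortest-path distance matrix and $\vec 1$ the all-ones vector. A curvature potential is a vector $\vec x$ with $D\vec x=\vec 1$; $G$ is distance exceptional if it has no curvature potential. Let $X(G)=\{D\vec x:\vec x\in\mathbb{R}^n,\ \vec x^\top\vec 1=1\}$. If $G$ is distance exceptional or has a curvature potential $\vec x$ with $\vec 1^\top\vec x\ne 0$, then $X(G)\cap\mathbb{R}\vec 1$ is a single point, and the curvature index $\iota(G)\in\mathbb{R}$ is defined by $X(G)\cap\mathbb{R}\vec 1=\{\iota(G)\vec 1\}$; otherwise (G not distance exceptional and all curvature potentials have coordinate sum zero) $\iota(G):=\infty$.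
   Formalization: Curvature potentials, whose existence and coordinate sums decide whether $\iota(G')<\infty$, are taken with rational coordinates rather than real ones. -}

module Defs where

open import Data.Nat using (ℕ; zero; suc)
open import Data.Bool using (Bool; true; false; _∧_; _∨_; if_then_else_; T)
open import Data.Fin using (Fin; zero; suc)
open import Data.Fin.Properties using () renaming (_≟_ to _≟ᶠ_)
open import Data.Integer using (+_)
open import Data.Rational using (ℚ; _/_; 0ℚ; 1ℚ) renaming (_+_ to _+ℚ_; _*_ to _*ℚ_)
open import Data.Product using (Σ; _×_; ∃-syntax)
open import Function.Definitions using (Injective)
open import Relation.Nullary using (¬_; does)
open import Relation.Binary.PropositionalEquality using (_≡_)

record Graph (n : ℕ) : Set where
  field
    adj    : Fin n → Fin n → Bool
    sym    : ∀ u v → adj u v ≡ adj v u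
    irrefl : ∀ u → adj u u ≡ false
open Graph public

anyFin : ∀ {n} → (Fin n → Bool) → Bool
anyFin {zero}  p = false
anyFin {suc n} p = p zero ∨ anyFin (λ i → p (suc i))

Σℚ : ∀ {n} → (Fin n → ℚ) → ℚ
Σℚ {zero}  f = 0ℚ
Σℚ {suc n} f = f zero +ℚ Σℚ (λ i → f (suc i))

reach : ∀ {n} → Graph n → ℕ → Fin n → Fin n → Bool
reach G zero    u v = does (u ≟ᶠ v)
reach G (suc k) u v = reach G k u v ∨ anyFin (λ w → reach G k u w ∧ adj G w v)

Connected : ∀ {n} → Graph n → Set
Connected G = ∀ u v → ∃[ k ] T (reach G k u v)

-- Least k ≥ i such that p k holds, searching at most `fuel` steps
-- (returns i + fuel if none is found).
searchFrom : (ℕ → Bool) → ℕ → ℕ → ℕ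
searchFrom p i zero       = i
searchFrom p i (suc fuel) = if p i then i else searchFrom p (suc i) fuel

-- Shortest-path distance d(u,v): the least k such that a walk of length ≤ k
-- joins u and v.  In a connected graph on n vertices d(u,v) ≤ n - 1, so a
-- search over 0..n is exhaustive.
dist : ∀ {n} → Graph n → Fin n → Fin n → ℕ
dist {n} G u v = searchFrom (λ k → reach G k u v) 0 n

D : ∀ {n} → Graph n → Fin n → Fin n → ℚ
D G u v = (+ dist G u v) / 1

CurvaturePotential : ∀ {n} → Graph n → (Fin n → ℚ) → Set
CurvaturePotential G x = ∀ u → Σℚ (λ v → D G u v *ℚ x v) ≡ 1ℚ

DistanceExceptional : ∀ {n} → Graph n → Set
DistanceExceptional {n} G = ¬ (Σ (Fin n → ℚ) (CurvaturePotential G))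

-- ι(G) = ∞ : G is not distance exceptional and every curvature potential
-- has coordinate sum zero.
IndexInfinite : ∀ {n} → Graph n → Set
IndexInfinite G =
  ¬ DistanceExceptional G × (∀ x → CurvaturePotential G x → Σℚ x ≡ 0ℚ)

IndexFinite : ∀ {n} → Graph n → Set
IndexFinite G = ¬ IndexInfinite G

InducedCopy : ∀ {n m} → Graph n → Graph m → Set
InducedCopy {n} {m} G G' =
  Σ (Fin n → Fin m) λ f → Injective _≡_ _≡_ f × (∀ u v → adj G' (f u) (f v) ≡ adj G u v)

{-# OPTIONS --safe #-}
module Submission where

-- For n ≥ 1 join G to two non-adjacent apexes a, b.  Every
-- vertex u then satisfies d(u,a) + d(u,b) = 2 (it is an apex, at distances 0
-- and 2 through a common neighbour in G, or a vertex of G, at distance 1 from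
-- both), so x = ½(eₐ + e_b) is a curvature potential with coordinate sum 1,
-- and ι is finite.  For n = 0 take K₁, whose distance matrix is 0, so it is
-- distance exceptional.

open import Defs hiding (sym)
open import Data.Nat using (ℕ; zero; suc; _≤_; _+_; z≤n; s≤s)
open import Data.Nat.Properties using (≤-reflexive; +-comm)
open import Data.Bool using (Bool; true; false; _∧_; _∨_; T)
open import Data.Bool.Properties using (∨-identityʳ; ∨-zeroʳ; T-≡)
open import Data.Fin using (Fin; zero; suc)
open import Data.Fin.Properties using (suc-injective) renaming (_≟_ to _≟ᶠ_)
open import Data.Integer using (+_)
open import Data.Rational using (ℚ; _/_; 0ℚ; 1ℚ; ½) renaming (_+_ to _+ℚ_; _*_ to _*ℚ_)
open import Data.Rational.Properties using (*-zeroˡ; *-zeroʳ; 1≢0)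
open import Data.Product using (Σ; _×_; ∃-syntax; _,_)
open import Function using (Equivalence)
open import Relation.Nullary using (does)
open import Relation.Nullary.Decidable using (dec-true; dec-false)
open import Relation.Binary.PropositionalEquality
  using (_≡_; _≢_; refl; sym; trans; cong; cong₂; module ≡-Reasoning)

private
  variable
    n : ℕ

anyFin-const-false : anyFin {n} (λ _ → false) ≡ false
anyFin-const-false {zero}  = refl
anyFin-const-false {suc n} = anyFin-const-false {n}

anyFin-intro : (p : Fin n → Bool) (j : Fin n) → p j ≡ true → anyFin p ≡ true
anyFin-intro p zero    pj = cong (_∨ anyFin (λ i → p (suc i))) pj
anyFin-intro p (suc j) pj =
  trans (cong (p zero ∨_) (anyFin-intro (λ i → p (suc i)) j pj)) (∨-zeroʳ (p zero))

anyFin-≟-∧ : (u : Fin n) (p : Fin n → Bool) → anyFin (λ w → does (u ≟ᶠ w) ∧ p w) ≡ p u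
anyFin-≟-∧ {suc n} zero    p =
  trans (cong (p zero ∨_) (anyFin-const-false {n})) (∨-identityʳ (p zero))
anyFin-≟-∧         (suc u) p = anyFin-≟-∧ u (λ i → p (suc i))

Σℚ-zero : (f : Fin n → ℚ) → (∀ i → f i ≡ 0ℚ) → Σℚ f ≡ 0ℚ
Σℚ-zero {zero}  f f≡0 = refl
Σℚ-zero {suc n} f f≡0 =
  cong₂ _+ℚ_ (f≡0 zero) (Σℚ-zero (λ i → f (suc i)) (λ i → f≡0 (suc i)))

searchFrom-hit : ∀ p i fuel → p i ≡ true → searchFrom p i fuel ≡ i
searchFrom-hit p i zero       pi = refl
searchFrom-hit p i (suc fuel) pi rewrite pi = refl

searchFrom-miss : ∀ p i fuel → p i ≡ false → searchFrom p i (suc fuel) ≡ searchFrom p (suc i) fuel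
searchFrom-miss p i fuel pi rewrite pi = refl

module _ (G : Graph n) where

  reach-refl : ∀ u → reach G 0 u u ≡ true
  reach-refl u = dec-true (u ≟ᶠ u) refl

  reach-≢ : ∀ {u v} → u ≢ v → reach G 0 u v ≡ false
  reach-≢ {u} {v} = dec-false (u ≟ᶠ v)

  reach-1 : ∀ u v → reach G 1 u v ≡ does (u ≟ᶠ v) ∨ adj G u v
  reach-1 u v = cong (does (u ≟ᶠ v) ∨_) (anyFin-≟-∧ u (λ w → adj G w v))

  reach-step : ∀ k u w v → reach G k u w ≡ true → adj G w v ≡ true → reach G (suc k) u v ≡ true
  reach-step k u w v uw wv = trans (cong (reach G k u v ∨_) some-step) (∨-zeroʳ _)
    where
    some-step : anyFin (λ w′ → reach G k u w′ ∧ adj G w′ v) ≡ true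
    some-step = anyFin-intro (λ w′ → reach G k u w′ ∧ adj G w′ v) w (cong₂ _∧_ uw wv)

  reach-adj : ∀ u v → adj G u v ≡ true → reach G 1 u v ≡ true
  reach-adj u v = reach-step 0 u u v (reach-refl u)

  reach-common-neighbour : ∀ u w v → adj G u w ≡ true → adj G w v ≡ true → reach G 2 u v ≡ true
  reach-common-neighbour u w v uw = reach-step 1 u w v (reach-adj u w uw)

  adj⇒≢ : ∀ {u v} → adj G u v ≡ true → u ≢ v
  adj⇒≢ {u} uu refl with trans (sym uu) (irrefl G u)
  ... | ()

dist-refl : (G : Graph (suc n)) (u : Fin (suc n)) → dist G u u ≡ 0
dist-refl {n} G u = searchFrom-hit (λ k → reach G k u u) 0 (suc n) (reach-refl G u)

module _ (G : Graph (suc (suc n))) (u v : Fin (suc (suc n))) where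

  private
    reaches : ℕ → Bool
    reaches k = reach G k u v

  dist-adj : adj G u v ≡ true → dist G u v ≡ 1
  dist-adj uv = trans (searchFrom-miss reaches 0 (suc n) (reach-≢ G (adj⇒≢ G uv)))
                      (searchFrom-hit reaches 1 (suc n) (reach-adj G u v uv))

  dist-common-neighbour : ∀ w → u ≢ v → adj G u v ≡ false →
                          adj G u w ≡ true → adj G w v ≡ true → dist G u v ≡ 2
  dist-common-neighbour w u≢v uv uw wv = begin
    dist G u v                   ≡⟨ searchFrom-miss reaches 0 (suc n) (reach-≢ G u≢v) ⟩
    searchFrom reaches 1 (suc n) ≡⟨ searchFrom-miss reaches 1 n reach₁≡false ⟩
    searchFrom reaches 2 n       ≡⟨ searchFrom-hit reaches 2 n reach₂≡true ⟩
    2                            ∎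
    where
    open ≡-Reasoning
    reach₁≡false : reach G 1 u v ≡ false
    reach₁≡false = trans (reach-1 G u v) (cong₂ _∨_ (dec-false (u ≟ᶠ v) u≢v) uv)
    reach₂≡true : reach G 2 u v ≡ true
    reach₂≡true = reach-common-neighbour G u w v uw wv

potential-sum≢0⇒IndexFinite : (G : Graph n) (x : Fin n → ℚ) →
                              CurvaturePotential G x → Σℚ x ≢ 0ℚ → IndexFinite G
potential-sum≢0⇒IndexFinite G x potential sum≢0 (_ , sums-vanish) =
  sum≢0 (sums-vanish x potential)

DistanceExceptional⇒IndexFinite : (G : Graph n) → DistanceExceptional G → IndexFinite G
DistanceExceptional⇒IndexFinite G exceptional (¬exceptional , _) = ¬exceptional exceptional

reach⇒connects : ∀ {G : Graph n} k {u v} → reach G k u v ≡ true → ∃[ k ] T (reach G k u v)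
reach⇒connects k r = k , Equivalence.from T-≡ r

halves-sum-to-one : ∀ p q → p + q ≡ 2 → (+ p / 1) *ℚ ½ +ℚ ((+ q / 1) *ℚ ½ +ℚ 0ℚ) ≡ 1ℚ
halves-sum-to-one 0 _ refl = refl
halves-sum-to-one 1 _ refl = refl
halves-sum-to-one 2 _ refl = refl

pattern apex₀  = zero
pattern apex₁  = suc zero
pattern base i = suc (suc i)

suspension-adj : Graph n → Fin (suc (suc n)) → Fin (suc (suc n)) → Bool
suspension-adj G (base i) (base j) = adj G i j
suspension-adj G (base i) _        = true
suspension-adj G _        (base j) = true
suspension-adj G _        _        = false

module _ (G : Graph n) where

  suspension-adj-sym : ∀ u v → suspension-adj G u v ≡ suspension-adj G v u
  suspension-adj-sym (base i) (base j) = Graph.sym G i j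
  suspension-adj-sym (base i) apex₀    = refl
  suspension-adj-sym (base i) apex₁    = refl
  suspension-adj-sym apex₀    (base j) = refl
  suspension-adj-sym apex₁    (base j) = refl
  suspension-adj-sym apex₀    apex₀    = refl
  suspension-adj-sym apex₀    apex₁    = refl
  suspension-adj-sym apex₁    apex₀    = refl
  suspension-adj-sym apex₁    apex₁    = refl

  suspension-adj-irrefl : ∀ u → suspension-adj G u u ≡ false
  suspension-adj-irrefl (base i) = irrefl G i
  suspension-adj-irrefl apex₀    = refl
  suspension-adj-irrefl apex₁    = refl

  suspension : Graph (suc (suc n))
  suspension = record
    { adj = suspension-adj G ; sym = suspension-adj-sym ; irrefl = suspension-adj-irrefl }

  apex-potential : Fin (suc (suc n)) → ℚ
  apex-potential (base _) = 0ℚ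
  apex-potential _        = ½

  apex-potential-sum : Σℚ apex-potential ≡ 1ℚ
  apex-potential-sum = cong (λ t → ½ +ℚ (½ +ℚ t)) (Σℚ-zero {n} (λ _ → 0ℚ) (λ _ → refl))

  suspension-induced : InducedCopy G suspension
  suspension-induced = base , (λ eq → suc-injective (suc-injective eq)) , (λ _ _ → refl)

  module _ (i₀ : Fin n) where

    suspension-connected : Connected suspension
    suspension-connected apex₀    apex₀    = reach⇒connects 0 (reach-refl suspension apex₀)
    suspension-connected apex₁    apex₁    = reach⇒connects 0 (reach-refl suspension apex₁)
    suspension-connected apex₀    apex₁    =
      reach⇒connects 2 (reach-common-neighbour suspension apex₀ (base i₀) apex₁ refl refl)
    suspension-connected apex₁    apex₀    =
      reach⇒connects 2 (reach-common-neighbour suspension apex₁ (base i₀) apex₀ refl refl)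
    suspension-connected apex₀    (base j) = reach⇒connects 1 (reach-adj suspension apex₀ (base j) refl)
    suspension-connected apex₁    (base j) = reach⇒connects 1 (reach-adj suspension apex₁ (base j) refl)
    suspension-connected (base i) apex₀    = reach⇒connects 1 (reach-adj suspension (base i) apex₀ refl)
    suspension-connected (base i) apex₁    = reach⇒connects 1 (reach-adj suspension (base i) apex₁ refl)
    suspension-connected (base i) (base j) =
      reach⇒connects 2 (reach-common-neighbour suspension (base i) apex₀ (base j) refl refl)

    apex-dist-sum : ∀ u → dist suspension u apex₀ + dist suspension u apex₁ ≡ 2
    apex-dist-sum apex₀    = cong₂ _+_
      (dist-refl suspension apex₀)
      (dist-common-neighbour suspension apex₀ apex₁ (base i₀) (λ ()) refl refl refl)
    apex-dist-sum apex₁    = cong₂ _+_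
      (dist-common-neighbour suspension apex₁ apex₀ (base i₀) (λ ()) refl refl refl)
      (dist-refl suspension apex₁)
    apex-dist-sum (base i) = cong₂ _+_
      (dist-adj suspension (base i) apex₀ refl)
      (dist-adj suspension (base i) apex₁ refl)

    suspension-potential : CurvaturePotential suspension apex-potential
    suspension-potential u = begin
      Σℚ (λ v → D suspension u v *ℚ apex-potential v)
        ≡⟨ cong (λ t → D suspension u apex₀ *ℚ ½ +ℚ (D suspension u apex₁ *ℚ ½ +ℚ t))
                (Σℚ-zero _ (λ i → *-zeroʳ (D suspension u (base i)))) ⟩
      D suspension u apex₀ *ℚ ½ +ℚ (D suspension u apex₁ *ℚ ½ +ℚ 0ℚ)
        ≡⟨ halves-sum-to-one (dist suspension u apex₀) (dist suspension u apex₁) (apex-dist-sum u) ⟩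
      1ℚ ∎
      where open ≡-Reasoning

    suspension-IndexFinite : IndexFinite suspension
    suspension-IndexFinite = potential-sum≢0⇒IndexFinite suspension apex-potential
      suspension-potential (λ sum≡0 → 1≢0 (trans (sym apex-potential-sum) sum≡0))

K₁ : Graph 1
K₁ = record { adj = λ _ _ → false ; sym = λ _ _ → refl ; irrefl = λ _ → refl }

K₁-connected : Connected K₁
K₁-connected zero zero = 0 , _

K₁-DistanceExceptional : DistanceExceptional K₁
K₁-DistanceExceptional (x , Dx≡1) =
  1≢0 (trans (sym (Dx≡1 zero)) (cong (_+ℚ 0ℚ) (*-zeroˡ (x zero))))

lemma5p1 : (n : ℕ) (G : Graph n) →
    ∃[ m ] (m ≤ n + 2 × Σ (Graph m) (λ G' → Connected G' × InducedCopy G G' × IndexFinite G'))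
lemma5p1 zero    G = 1 , s≤s z≤n , K₁ , K₁-connected , ((λ ()) , (λ {}) , (λ ())) ,
  DistanceExceptional⇒IndexFinite K₁ K₁-DistanceExceptional
lemma5p1 (suc n) G = 3 + n , ≤-reflexive (+-comm 2 (suc n)) , suspension G ,
  suspension-connected G zero , suspension-induced G , suspension-IndexFinite G zero
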